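{- For $n\ge 3$, $\dim_{1,f}(C_n)=\frac n2$ if $n\in\{3,4\}$, and $\dim_{1,f}(C_n)=\frac n4$ if $n\ge 5$.
   Context: $C_n$ is the cycle on $n$ vertices. $d(x,y)$ denotes the distance in a graph $G$. Let $d_1(x,y)=\min\{d(x,y),2\}$ and, for distinct $x,y\in V(G)$, $R_1\{x,y\}=\{z\in V(G): d_1(x,z)\neq d_1(y,z)\}$. For $g$ defined on $V(G)$ and $U\subseteq V(G)$, $g(U)=\sum_{s\in U}g(s)$. A function $h:V(G)\to[0,1]$ is a $1$-truncated resolving function of $G$ if $h(R_1\{x,y\})\ge 1$ for all distinct $x,y\in V(G)$; $\dim_{1,f}(G)$ is the minimum of $h(V(G))$ over all $1$-truncated resolving functions $h$ of $G$.
   Formalization: The 1-truncated resolving functions h take rational values in $[0,1]$ rather than real ones. -}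

module Defs where

open import Data.Nat as ℕ using (ℕ; _⊓_; _∸_; _≡ᵇ_; ∣_-_∣)
open import Data.Fin using (Fin; toℕ)
open import Data.List using (List; map; foldr; allFin)
open import Data.Bool using (Bool; if_then_else_; not)
open import Data.Product using (_×_; Σ)
open import Data.Rational using (ℚ; 0ℚ; 1ℚ; _+_; _≤_)
open import Relation.Binary.PropositionalEquality using (_≡_; _≢_)

-- Vertices of C_n are Fin n; i and j are adjacent iff they differ by 1 mod n.
-- Graph distance in C_n.
cycDist : (n : ℕ) → Fin n → Fin n → ℕ
cycDist n i j = ∣ toℕ i - toℕ j ∣ ⊓ (n ∸ ∣ toℕ i - toℕ j ∣)

d₁ : (n : ℕ) → Fin n → Fin n → ℕ
d₁ n x y = cycDist n x y ⊓ 2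

inR₁ : (n : ℕ) → Fin n → Fin n → Fin n → Bool
inR₁ n x y z = not (d₁ n x z ≡ᵇ d₁ n y z)

sumV : (n : ℕ) → (Fin n → ℚ) → ℚ
sumV n f = foldr _+_ 0ℚ (map f (allFin n))

weightR₁ : (n : ℕ) → (Fin n → ℚ) → Fin n → Fin n → ℚ
weightR₁ n h x y = sumV n (λ z → if inR₁ n x y z then h z else 0ℚ)

IsTruncResolving : (n : ℕ) → (Fin n → ℚ) → Set
IsTruncResolving n h =
  ((v : Fin n) → (0ℚ ≤ h v) × (h v ≤ 1ℚ)) ×
  ((x y : Fin n) → x ≢ y → 1ℚ ≤ weightR₁ n h x y)

Dim1f≡ : (n : ℕ) → ℚ → Set
Dim1f≡ n r =
  Σ (Fin n → ℚ) (λ h → IsTruncResolving n h × (sumV n h ≡ r)) ×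
  ((h : Fin n → ℚ) → IsTruncResolving n h → r ≤ sumV n h)

{-# OPTIONS --safe #-}

-- The rotation i ↦ i + 1 is an automorphism of Cₙ, so it preserves R₁ and transports weights.
-- Lower bounds: if some pair is resolved only inside a window of w vertices, the resolving constraints
-- of its n rotations add up to w · h(V) ≥ n, because every vertex lies in exactly w rotated windows.
-- For n ≥ 5 the adjacent pair {1, 2} is resolved only by {0, 1, 2, 3}; in C₃ and C₄ the pairs {0, 1}
-- and {0, 2} are resolved only by themselves.
-- Upper bounds: for n ≥ 5 every pair {0, y} is resolved by 0, y, a neighbour of 0 at distance ≥ 2
-- from y and a neighbour of y at distance ≥ 2 from 0, so by rotation the constant 1/4 is resolving;
-- for n ≤ 4 the constant 1/2 is checked by evaluation.

module Submission where

open import Defs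
open import Data.Nat using (ℕ; _≤_)
open import Data.Integer using (+_)
open import Data.Rational using (_/_)
open import Data.Product using (_×_)

open import Algebra.Bundles using (CommutativeMonoid; CommutativeRing)
open import Data.Bool using (true; false; if_then_else_; not)
open import Data.Fin using (Fin; zero; suc; toℕ; fromℕ; fromℕ<; inject₁)
import Data.Fin.Properties as FinP
import Data.Integer.Solver as ℤSolver
open import Data.List using ([]; _∷_; map; foldr; tabulate)
open import Data.List.Properties using (map-tabulate)
open import Data.List.Relation.Unary.All using (All; []; _∷_)
open import Data.List.Relation.Unary.AllPairs using ([]; _∷_)
open import Data.List.Relation.Unary.Unique.Propositional using (Unique)
open import Data.Nat as ℕ using (zero; suc; z≤n; s≤s; _<_; _⊓_; _∸_; ∣_-_∣; _<?_)
import Data.Nat.Properties as ℕP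
open import Data.Product using (_,_; proj₁)
open import Data.Rational as ℚ using (ℚ; 0ℚ; 1ℚ; _+_; _*_)
import Data.Rational.Properties as ℚP
import Data.Rational.Unnormalised as ℚᵘ
import Data.Rational.Unnormalised.Properties as ℚᵘP
open import Data.Sum using (_⊎_; inj₁; inj₂)
open import Data.Vec.Functional using (updateAt)
open import Data.Vec.Functional.Properties using (updateAt-updates; updateAt-minimal)
open import Function using (_∘_; id; const)
open import Relation.Binary.PropositionalEquality
open import Relation.Nullary using (Dec; yes; no; ¬?; _×-dec_; _→-dec_; contradiction)
open import Relation.Nullary.Decidable using (dec-false; toWitness)

open import Algebra.Properties.CommutativeMonoid.Sum ℚP.+-0-commutativeMonoid
  using (sum; sum-syntax; sum-cong-≗; sum-init-last; sum-replicate-zero; ∑-comm)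
open import Algebra.Properties.Semiring.Sum (CommutativeRing.semiring ℚP.+-*-commutativeRing)
  using (*-distribˡ-sum; *-distribʳ-sum)
open import Algebra.Properties.CommutativeSemigroup
  (CommutativeMonoid.commutativeSemigroup ℚP.+-0-commutativeMonoid)
  using (x∙yz≈y∙xz)

sumV≡sum : ∀ n (f : Fin n → ℚ) → sumV n f ≡ sum f
sumV≡sum n f = trans (cong (foldr _+_ 0ℚ) (map-tabulate id f)) (foldr-tabulate n f)
  where
  foldr-tabulate : ∀ n (g : Fin n → ℚ) → foldr _+_ 0ℚ (tabulate g) ≡ sum g
  foldr-tabulate zero    g = refl
  foldr-tabulate (suc n) g = cong (_+_ (g zero)) (foldr-tabulate n (g ∘ suc))

sum-mono-≤ : ∀ {n} {f g : Fin n → ℚ} → (∀ i → f i ℚ.≤ g i) → sum f ℚ.≤ sum g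
sum-mono-≤ {zero}  f≤g = ℚP.≤-refl
sum-mono-≤ {suc n} f≤g = ℚP.+-mono-≤ (f≤g zero) (sum-mono-≤ (f≤g ∘ suc))

sum-nonNeg : ∀ {n} {f : Fin n → ℚ} → (∀ i → 0ℚ ℚ.≤ f i) → 0ℚ ℚ.≤ sum f
sum-nonNeg {n} {f} f≥0 = subst (ℚ._≤ sum f) (sum-replicate-zero n) (sum-mono-≤ f≥0)

sum-updateAt-0 : ∀ {n} (g : Fin n → ℚ) w → sum g ≡ g w + sum (updateAt g w (const 0ℚ))
sum-updateAt-0 g zero    = cong (_+_ (g zero)) (sym (ℚP.+-identityˡ _))
sum-updateAt-0 g (suc w) =
  trans (cong (_+_ (g zero)) (sum-updateAt-0 (g ∘ suc) w)) (x∙yz≈y∙xz (g zero) (g (suc w)) _)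

sum-distinct-≤ : ∀ {n} {g : Fin n → ℚ} → (∀ z → 0ℚ ℚ.≤ g z) →
                 ∀ {ws} → Unique ws → foldr _+_ 0ℚ (map g ws) ℚ.≤ sum g
sum-distinct-≤ g≥0 [] = sum-nonNeg g≥0
sum-distinct-≤ {g = g} g≥0 {w ∷ ws} (w∉ws ∷ ws-distinct) = begin
  g w + foldr _+_ 0ℚ (map g ws)  ≡⟨ cong (_+_ (g w)) (agree w∉ws) ⟩
  g w + foldr _+_ 0ℚ (map g′ ws) ≤⟨ ℚP.+-monoʳ-≤ (g w) (sum-distinct-≤ g′≥0 ws-distinct) ⟩
  g w + sum g′                   ≡⟨ sum-updateAt-0 g w ⟨
  sum g                          ∎
  where
  open ℚP.≤-Reasoning
  g′ : Fin _ → ℚ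
  g′ = updateAt g w (const 0ℚ)
  g′≥0 : ∀ z → 0ℚ ℚ.≤ g′ z
  g′≥0 z with z FinP.≟ w
  ... | yes refl = ℚP.≤-reflexive (sym (updateAt-updates w g))
  ... | no z≢w   = subst (0ℚ ℚ.≤_) (sym (updateAt-minimal z w g z≢w)) (g≥0 z)
  agree : ∀ {zs} → All (w ≢_) zs → foldr _+_ 0ℚ (map g zs) ≡ foldr _+_ 0ℚ (map g′ zs)
  agree []           = refl
  agree (w≢z ∷ w≢zs) = cong₂ _+_ (sym (updateAt-minimal _ w g (w≢z ∘ sym))) (agree w≢zs)

1/d+n/d≡[1+n]/d : ∀ n d → + 1 / suc d + + n / suc d ≡ + suc n / suc d
1/d+n/d≡[1+n]/d n d = ℚP.toℚᵘ-injective (begin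
  ℚ.toℚᵘ (+ 1 / suc d + + n / suc d)
    ≈⟨ ℚP.toℚᵘ-homo-+ (+ 1 / suc d) (+ n / suc d) ⟩
  ℚ.toℚᵘ (+ 1 / suc d) ℚᵘ.+ ℚ.toℚᵘ (+ n / suc d)
    ≈⟨ ℚᵘP.+-cong (ℚP.toℚᵘ-fromℚᵘ (ℚᵘ.mkℚᵘ (+ 1) d)) (ℚP.toℚᵘ-fromℚᵘ (ℚᵘ.mkℚᵘ (+ n) d)) ⟩
  ℚᵘ.mkℚᵘ (+ 1) d ℚᵘ.+ ℚᵘ.mkℚᵘ (+ n) d
    ≈⟨ ℚᵘ.*≡* (solve 2 (λ N D → (con (+ 1) :* D :+ N :* D) :* D := (con (+ 1) :+ N) :* (D :* D))
                        refl (+ n) (+ suc d)) ⟩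
  ℚᵘ.mkℚᵘ (+ suc n) d
    ≈⟨ ℚP.toℚᵘ-fromℚᵘ (ℚᵘ.mkℚᵘ (+ suc n) d) ⟨
  ℚ.toℚᵘ (+ suc n / suc d) ∎)
  where open ℚᵘP.≃-Reasoning; open ℤSolver.+-*-Solver

sum-const-1/ : ∀ n d → ∑[ i < n ] (+ 1 / suc d) ≡ + n / suc d
sum-const-1/ zero    d = sym (ℚP.0/n≡0 (suc d))
sum-const-1/ (suc n) d = trans (cong (_+_ (+ 1 / suc d)) (sum-const-1/ n d)) (1/d+n/d≡[1+n]/d n d)

onR₁ : ∀ {n} → (Fin n → ℚ) → Fin n → Fin n → Fin n → ℚ
onR₁ {n} h x y z = if inR₁ n x y z then h z else 0ℚ

weightR₁≡sum : ∀ {n} (h : Fin n → ℚ) x y → weightR₁ n h x y ≡ sum (onR₁ h x y)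
weightR₁≡sum {n} h x y = sumV≡sum n (onR₁ h x y)

dist : ℕ → ℕ → ℕ → ℕ
dist n i j = ∣ i - j ∣ ⊓ (n ∸ ∣ i - j ∣)

dist-sym : ∀ n i j → dist n i j ≡ dist n j i
dist-sym n i j = cong (λ d → d ⊓ (n ∸ d)) (ℕP.∣-∣-comm i j)

dist-self : ∀ n i → dist n i i ≡ 0
dist-self n i = cong (λ d → d ⊓ (n ∸ d)) (ℕP.∣n-n∣≡0 i)

dist-wrap : ∀ {m j} → j < m → dist (suc m) 0 (suc j) ≡ dist (suc m) m j
dist-wrap {m} {j} j<m = begin
  suc j ⊓ (m ∸ j)                         ≡⟨ ℕP.⊓-comm (suc j) (m ∸ j) ⟩
  (m ∸ j) ⊓ suc j                         ≡⟨ cong ((m ∸ j) ⊓_) suc-m∸[m∸j]≡suc-j ⟨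
  (m ∸ j) ⊓ (suc m ∸ (m ∸ j))             ≡⟨ cong (λ d → d ⊓ (suc m ∸ d)) (ℕP.m≤n⇒∣n-m∣≡n∸m j≤m) ⟨
  dist (suc m) m j                        ∎
  where
  open ≡-Reasoning
  j≤m : j ≤ m
  j≤m = ℕP.<⇒≤ j<m
  suc-m∸[m∸j]≡suc-j : suc m ∸ (m ∸ j) ≡ suc j
  suc-m∸[m∸j]≡suc-j = trans (ℕP.+-∸-assoc 1 (ℕP.m∸n≤m m j)) (cong suc (ℕP.m∸[m∸n]≡n j≤m))

dist-≥ : ∀ {n i j} k → k ≤ ∣ i - j ∣ → k ℕ.+ ∣ i - j ∣ ≤ n → k ≤ dist n i j
dist-≥ k k≤d k+d≤n = ℕP.⊓-glb k≤d (ℕP.m+n≤o⇒m≤o∸n k k+d≤n)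

cycDist≡dist : ∀ {n} {x y : Fin n} {i j} → toℕ x ≡ i → toℕ y ≡ j → cycDist n x y ≡ dist n i j
cycDist≡dist {n} = cong₂ (dist n)

rot : ∀ {m} → Fin (suc m) → Fin (suc m)
rot {m} i with toℕ i <? m
... | yes i<m = suc (fromℕ< i<m)
... | no _    = zero

toℕ-rot : ∀ {m} (i : Fin (suc m)) →
          (toℕ i < m × toℕ (rot i) ≡ suc (toℕ i)) ⊎ (toℕ i ≡ m × toℕ (rot i) ≡ 0)
toℕ-rot {m} i with toℕ i <? m
... | yes i<m = inj₁ (i<m , cong suc (FinP.toℕ-fromℕ< i<m))
... | no  i≮m = inj₂ (ℕP.≤∧≮⇒≡ (FinP.toℕ≤pred[n] i) i≮m , refl)

rot-injective : ∀ {m} {i j : Fin (suc m)} → rot i ≡ rot j → i ≡ j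
rot-injective {i = i} {j} eq with toℕ-rot i | toℕ-rot j
... | inj₁ (_ , ri)  | inj₁ (_ , rj)  = FinP.toℕ-injective (ℕP.suc-injective (trans (sym ri) (trans (cong toℕ eq) rj)))
... | inj₁ (_ , ri)  | inj₂ (_ , rj)  = contradiction (trans (sym ri) (trans (cong toℕ eq) rj)) λ ()
... | inj₂ (_ , ri)  | inj₁ (_ , rj)  = contradiction (trans (sym ri) (trans (cong toℕ eq) rj)) λ ()
... | inj₂ (i≡m , _) | inj₂ (j≡m , _) = FinP.toℕ-injective (trans i≡m (sym j≡m))

cycDist-rot : ∀ {m} (x y : Fin (suc m)) → cycDist (suc m) (rot x) (rot y) ≡ cycDist (suc m) x y
cycDist-rot {m} x y with toℕ-rot x | toℕ-rot y
... | inj₁ (_ , rx) | inj₁ (_ , ry) = cycDist≡dist rx ry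
... | inj₂ (x≡m , rx) | inj₁ (y<m , ry) = begin
  cycDist (suc m) (rot x) (rot y) ≡⟨ cycDist≡dist rx ry ⟩
  dist (suc m) 0 (suc (toℕ y))    ≡⟨ dist-wrap y<m ⟩
  dist (suc m) m (toℕ y)          ≡⟨ cycDist≡dist {x = x} {y} x≡m refl ⟨
  cycDist (suc m) x y             ∎
  where open ≡-Reasoning
... | inj₁ (x<m , rx) | inj₂ (y≡m , ry) = begin
  cycDist (suc m) (rot x) (rot y) ≡⟨ cycDist≡dist rx ry ⟩
  dist (suc m) (suc (toℕ x)) 0    ≡⟨ dist-sym (suc m) (suc (toℕ x)) 0 ⟩
  dist (suc m) 0 (suc (toℕ x))    ≡⟨ dist-wrap x<m ⟩
  dist (suc m) m (toℕ x)          ≡⟨ dist-sym (suc m) m (toℕ x) ⟩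
  dist (suc m) (toℕ x) m          ≡⟨ cycDist≡dist {x = x} {y} refl y≡m ⟨
  cycDist (suc m) x y             ∎
  where open ≡-Reasoning
... | inj₂ (x≡m , rx) | inj₂ (y≡m , ry) = begin
  cycDist (suc m) (rot x) (rot y) ≡⟨ cycDist≡dist rx ry ⟩
  dist (suc m) 0 0                ≡⟨ dist-self (suc m) m ⟨
  dist (suc m) m m                ≡⟨ cycDist≡dist x≡m y≡m ⟨
  cycDist (suc m) x y             ∎
  where open ≡-Reasoning

rot-inject₁ : ∀ {m} (i : Fin m) → rot (inject₁ i) ≡ suc i
rot-inject₁ i with toℕ-rot (inject₁ i)
... | inj₁ (_ , r) = FinP.toℕ-injective (trans r (cong suc (FinP.toℕ-inject₁ i)))
... | inj₂ (i≡m , _) = contradiction (trans (sym (FinP.toℕ-inject₁ i)) i≡m) (ℕP.<⇒≢ (FinP.toℕ<n i))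

rot-fromℕ : ∀ m → rot (fromℕ m) ≡ zero
rot-fromℕ m with toℕ-rot (fromℕ m)
... | inj₁ (m<m , _) = contradiction (subst (_< m) (FinP.toℕ-fromℕ m) m<m) (ℕP.<-irrefl refl)
... | inj₂ (_ , r)   = FinP.toℕ-injective r

sum-rot : ∀ {m} (f : Fin (suc m) → ℚ) → sum (f ∘ rot) ≡ sum f
sum-rot {m} f = begin
  sum (f ∘ rot)                               ≡⟨ sum-init-last (f ∘ rot) ⟩
  sum (f ∘ rot ∘ inject₁) + f (rot (fromℕ m))
    ≡⟨ cong₂ _+_ (sum-cong-≗ (cong f ∘ rot-inject₁)) (cong f (rot-fromℕ m)) ⟩
  sum (f ∘ suc) + f zero                      ≡⟨ ℚP.+-comm (sum (f ∘ suc)) (f zero) ⟩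
  sum f                                       ∎
  where open ≡-Reasoning

rotate : ∀ {m} → ℕ → Fin (suc m) → Fin (suc m)
rotate zero    i = i
rotate (suc k) i = rot (rotate k i)

rotate-+ : ∀ {m} k l (i : Fin (suc m)) → rotate (k ℕ.+ l) i ≡ rotate k (rotate l i)
rotate-+ zero    l i = refl
rotate-+ (suc k) l i = cong rot (rotate-+ k l i)

rotate-comm : ∀ {m} k l (i : Fin (suc m)) → rotate k (rotate l i) ≡ rotate l (rotate k i)
rotate-comm k l i =
  trans (sym (rotate-+ k l i)) (trans (cong (λ s → rotate s i) (ℕP.+-comm k l)) (rotate-+ l k i))

rotate-injective : ∀ {m} k {i j : Fin (suc m)} → rotate k i ≡ rotate k j → i ≡ j
rotate-injective zero    eq = eq
rotate-injective (suc k) eq = rotate-injective k (rot-injective eq)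

toℕ-rotate-zero : ∀ {m} k → k ≤ m → toℕ (rotate {m} k zero) ≡ k
toℕ-rotate-zero zero    _   = refl
toℕ-rotate-zero {m} (suc k) k<m with toℕ-rot (rotate {m} k zero)
... | inj₁ (_ , r)   = trans r (cong suc (toℕ-rotate-zero k (ℕP.<⇒≤ k<m)))
... | inj₂ (k≡m , _) = contradiction (trans (sym (toℕ-rotate-zero k (ℕP.<⇒≤ k<m))) k≡m) (ℕP.<⇒≢ k<m)

rotate-toℕ : ∀ {m} (i : Fin (suc m)) → rotate (toℕ i) zero ≡ i
rotate-toℕ i = FinP.toℕ-injective (toℕ-rotate-zero (toℕ i) (FinP.toℕ≤pred[n] i))

rotate-full-turn : ∀ m → rotate (suc m) (zero {m}) ≡ zero
rotate-full-turn m with toℕ-rot (rotate {m} m zero)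
... | inj₁ (m<m , _) = contradiction (subst (_< m) (toℕ-rotate-zero m ℕP.≤-refl) m<m) (ℕP.<-irrefl refl)
... | inj₂ (_ , r)   = FinP.toℕ-injective r

rotate-to-zero : ∀ {m} (i : Fin (suc m)) → rotate (suc m ∸ toℕ i) i ≡ zero
rotate-to-zero {m} i = begin
  rotate (suc m ∸ toℕ i) i                      ≡⟨ cong (rotate (suc m ∸ toℕ i)) (rotate-toℕ i) ⟨
  rotate (suc m ∸ toℕ i) (rotate (toℕ i) zero)  ≡⟨ rotate-+ (suc m ∸ toℕ i) (toℕ i) zero ⟨
  rotate (suc m ∸ toℕ i ℕ.+ toℕ i) zero         ≡⟨ cong (λ k → rotate k zero) (ℕP.m∸n+n≡m (ℕP.<⇒≤ (FinP.toℕ<n i))) ⟩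
  rotate (suc m) zero                           ≡⟨ rotate-full-turn m ⟩
  zero                                          ∎
  where open ≡-Reasoning

sum-rotate : ∀ {m} k (f : Fin (suc m) → ℚ) → sum (f ∘ rotate k) ≡ sum f
sum-rotate zero    f = refl
sum-rotate (suc k) f = trans (sum-rotate k (f ∘ rot)) (sum-rot f)

cycDist-rotate : ∀ {m} k (x y : Fin (suc m)) →
                 cycDist (suc m) (rotate k x) (rotate k y) ≡ cycDist (suc m) x y
cycDist-rotate zero    x y = refl
cycDist-rotate (suc k) x y = trans (cycDist-rot (rotate k x) (rotate k y)) (cycDist-rotate k x y)

inR₁-rotate : ∀ {m} k (x y z : Fin (suc m)) →
              inR₁ (suc m) (rotate k x) (rotate k y) (rotate k z) ≡ inR₁ (suc m) x y z
inR₁-rotate k x y z =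
  cong₂ (λ a b → not ((a ⊓ 2) ℕ.≡ᵇ (b ⊓ 2))) (cycDist-rotate k x z) (cycDist-rotate k y z)

weightR₁-rotate : ∀ {m} k (h : Fin (suc m) → ℚ) (x y : Fin (suc m)) →
                  weightR₁ (suc m) h (rotate k x) (rotate k y) ≡ weightR₁ (suc m) (h ∘ rotate k) x y
weightR₁-rotate {m} k h x y = begin
  weightR₁ (suc m) h (rotate k x) (rotate k y)       ≡⟨ weightR₁≡sum h (rotate k x) (rotate k y) ⟩
  sum (onR₁ h (rotate k x) (rotate k y))             ≡⟨ sum-rotate k (onR₁ h (rotate k x) (rotate k y)) ⟨
  sum (onR₁ h (rotate k x) (rotate k y) ∘ rotate k)
    ≡⟨ sum-cong-≗ (λ z → cong (λ b → if b then h (rotate k z) else 0ℚ) (inR₁-rotate k x y z)) ⟩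
  sum (onR₁ (h ∘ rotate k) x y)                      ≡⟨ weightR₁≡sum (h ∘ rotate k) x y ⟨
  weightR₁ (suc m) (h ∘ rotate k) x y                ∎
  where open ≡-Reasoning

inR₁-separated : ∀ {n} {x y z : Fin n} → d₁ n x z ≢ d₁ n y z → inR₁ n x y z ≡ true
inR₁-separated {n} {x} {y} {z} d≢d = cong not (dec-false (d₁ n x z ℕP.≟ d₁ n y z) d≢d)

inR₁-far : ∀ {n} {x y z : Fin n} → 2 ≤ cycDist n x z → 2 ≤ cycDist n y z → inR₁ n x y z ≡ false
inR₁-far 2≤dxz 2≤dyz = cong₂ (λ a b → not (a ℕ.≡ᵇ b)) (ℕP.m≥n⇒m⊓n≡n 2≤dxz) (ℕP.m≥n⇒m⊓n≡n 2≤dyz)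

-- toℕ (fromℕ m) is stuck for a variable m, while after one rotation d₁ evaluates at zero.
inR₁-at-last : ∀ {m} {x y : Fin (suc m)} {b} →
               inR₁ (suc m) (rot x) (rot y) zero ≡ b → inR₁ (suc m) x y (fromℕ m) ≡ b
inR₁-at-last {m} {x} {y} eq =
  trans (sym (inR₁-rotate 1 x y (fromℕ m))) (trans (cong (inR₁ (suc m) (rot x) (rot y)) (rot-fromℕ m)) eq)

weightR₁-≥-distinct : ∀ {n} {h : Fin n → ℚ} → (∀ z → 0ℚ ℚ.≤ h z) → ∀ {x y ws} → Unique ws →
                      All (λ z → inR₁ n x y z ≡ true) ws → foldr _+_ 0ℚ (map h ws) ℚ.≤ weightR₁ n h x y
weightR₁-≥-distinct {n} {h} h≥0 {x} {y} {ws} distinct ws⊆R = begin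
  foldr _+_ 0ℚ (map h ws)              ≡⟨ agree ws⊆R ⟩
  foldr _+_ 0ℚ (map (onR₁ h x y) ws)   ≤⟨ sum-distinct-≤ onR₁≥0 distinct ⟩
  sum (onR₁ h x y)                     ≡⟨ weightR₁≡sum h x y ⟨
  weightR₁ n h x y                     ∎
  where
  open ℚP.≤-Reasoning
  onR₁≥0 : ∀ z → 0ℚ ℚ.≤ onR₁ h x y z
  onR₁≥0 z with inR₁ n x y z
  ... | true  = h≥0 z
  ... | false = ℚP.≤-refl
  agree : ∀ {zs} → All (λ z → inR₁ n x y z ≡ true) zs →
          foldr _+_ 0ℚ (map h zs) ≡ foldr _+_ 0ℚ (map (onR₁ h x y) zs)
  agree []           = refl
  agree (z∈R ∷ zs⊆R) = cong₂ _+_ (cong (λ b → if b then h _ else 0ℚ) (sym z∈R)) (agree zs⊆R)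

window : ∀ {m w} → (Fin w → ℕ) → (Fin (suc m) → ℚ) → Fin (suc m) → ℚ
window {w = w} offsets h b = ∑[ i < w ] h (rotate (offsets i) b)

sum-window : ∀ {m w} (offsets : Fin w → ℕ) (h : Fin (suc m) → ℚ) →
             ∑[ b < suc m ] window offsets h b ≡ ∑[ i < w ] sum h
sum-window offsets h =
  trans (∑-comm (λ b i → h (rotate (offsets i) b))) (sum-cong-≗ (λ i → sum-rotate (offsets i) h))

window-rotate : ∀ {m w} (offsets : Fin w → ℕ) (h : Fin (suc m) → ℚ) k →
                window offsets (h ∘ rotate k) zero ≡ window offsets h (rotate k zero)
window-rotate offsets h k = sum-cong-≗ (λ i → cong h (rotate-comm k (offsets i) zero))

averaging : ∀ {m w} (offsets : Fin w → ℕ) (h : Fin (suc m) → ℚ) {c} → 0ℚ ℚ.≤ c → ∑[ i < w ] c ≡ 1ℚ →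
            (∀ b → 1ℚ ℚ.≤ window offsets h b) → ∑[ b < suc m ] c ℚ.≤ sum h
averaging {m} {w} offsets h {c} c≥0 ∑c≡1 windows≥1 = begin
  ∑[ b < suc m ] c                         ≡⟨ sum-cong-≗ {suc m} (λ _ → ℚP.*-identityʳ c) ⟨
  ∑[ b < suc m ] (c * 1ℚ)
    ≤⟨ sum-mono-≤ (λ b → ℚP.*-monoˡ-≤-nonNeg c {{ℚ.nonNegative c≥0}} (windows≥1 b)) ⟩
  ∑[ b < suc m ] (c * window offsets h b)  ≡⟨ *-distribˡ-sum c (window offsets h) ⟨
  c * ∑[ b < suc m ] window offsets h b    ≡⟨ cong (c *_) (sum-window offsets h) ⟩
  c * ∑[ i < w ] sum h                     ≡⟨ *-distribˡ-sum {w} c (const (sum h)) ⟩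
  ∑[ i < w ] (c * sum h)                   ≡⟨ *-distribʳ-sum {w} (sum h) (const c) ⟨
  (∑[ i < w ] c) * sum h                   ≡⟨ cong (_* sum h) ∑c≡1 ⟩
  1ℚ * sum h                               ≡⟨ ℚP.*-identityˡ (sum h) ⟩
  sum h                                    ∎
  where open ℚP.≤-Reasoning

lower-bound-by-window : ∀ {m w} (p q : Fin (suc m)) → p ≢ q → (offsets : Fin w → ℕ) →
                        (∀ h → weightR₁ (suc m) h p q ℚ.≤ window offsets h zero) →
                        ∀ {c} → 0ℚ ℚ.≤ c → ∑[ i < w ] c ≡ 1ℚ →
                        ∀ h → IsTruncResolving (suc m) h → ∑[ b < suc m ] c ℚ.≤ sumV (suc m) h
lower-bound-by-window {m} p q p≢q offsets pq-window c≥0 ∑c≡1 h (_ , resolves) =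
  subst (_ ℚ.≤_) (sym (sumV≡sum (suc m) h)) (averaging offsets h c≥0 ∑c≡1 window≥1)
  where
  window≥1 : ∀ b → 1ℚ ℚ.≤ window offsets h b
  window≥1 b = begin
    1ℚ                                            ≤⟨ resolves (rotate k p) (rotate k q) (p≢q ∘ rotate-injective k) ⟩
    weightR₁ (suc m) h (rotate k p) (rotate k q)  ≡⟨ weightR₁-rotate k h p q ⟩
    weightR₁ (suc m) (h ∘ rotate k) p q           ≤⟨ pq-window (h ∘ rotate k) ⟩
    window offsets (h ∘ rotate k) zero            ≡⟨ window-rotate offsets h k ⟩
    window offsets h (rotate k zero)              ≡⟨ cong (window offsets h) (rotate-toℕ b) ⟩
    window offsets h b                            ∎
    where
    open ℚP.≤-Reasoning
    k : ℕ
    k = toℕ b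

resolving-from-zero : ∀ {m} c → (∀ y → y ≢ zero → 1ℚ ℚ.≤ weightR₁ (suc m) (const c) zero y) →
                      ∀ x y → x ≢ y → 1ℚ ℚ.≤ weightR₁ (suc m) (const c) x y
resolving-from-zero {m} c from-zero x y x≢y =
  subst (1ℚ ℚ.≤_) (weightR₁-rotate k (const c) x y)
    (subst (λ x′ → 1ℚ ℚ.≤ weightR₁ (suc m) (const c) x′ (rotate k y)) (sym (rotate-to-zero x))
      (from-zero (rotate k y) (λ ky≡0 → x≢y (rotate-injective k (trans (rotate-to-zero x) (sym ky≡0))))))
  where
  k : ℕ
  k = suc m ∸ toℕ x

¼ : ℚ
¼ = + 1 / 4

¼-bounds : 0ℚ ℚ.≤ ¼ × ¼ ℚ.≤ 1ℚ
¼-bounds = toWitness {a? = (0ℚ ℚP.≤? ¼) ×-dec (¼ ℚP.≤? 1ℚ)} _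

four-resolvers-¼ : ∀ {n} {x y : Fin n} a b c d → Unique (a ∷ b ∷ c ∷ d ∷ []) →
                   All (λ z → inR₁ n x y z ≡ true) (a ∷ b ∷ c ∷ d ∷ []) → 1ℚ ℚ.≤ weightR₁ n (const ¼) x y
four-resolvers-¼ {x = x} {y} a b c d =
  weightR₁-≥-distinct (λ _ → proj₁ ¼-bounds) {x} {y} {a ∷ b ∷ c ∷ d ∷ []}

module _ (j : ℕ) where

  private
    n : ℕ
    n = 5 ℕ.+ j

  adjacent-pair-window : ∀ h → weightR₁ n h (suc zero) (suc (suc zero)) ℚ.≤ window (toℕ {4}) h zero
  adjacent-pair-window h = ℚP.≤-reflexive (begin
    weightR₁ n h (suc zero) (suc (suc zero))
      ≡⟨ weightR₁≡sum h (suc zero) (suc (suc zero)) ⟩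
    -- the summands at 0, 1, 2, 3 evaluate to h 0, …, h 3
    h zero + (h (suc zero) + (h (suc (suc zero)) + (h (suc (suc (suc zero))) + ∑[ w < suc j ] far w)))
      ≡⟨ cong (λ s → h zero + (h (suc zero) + (h (suc (suc zero)) + (h (suc (suc (suc zero))) + s))))
              far-vanish ⟩
    window (toℕ {4}) h zero ∎)
    where
    open ≡-Reasoning
    far : Fin (suc j) → ℚ
    far w = onR₁ h (suc zero) (suc (suc zero)) (suc (suc (suc (suc w))))
    far-vanish : ∑[ w < suc j ] far w ≡ 0ℚ
    far-vanish = trans (sum-cong-≗ vanish) (sum-replicate-zero (suc j))
      where
      vanish : ∀ w → far w ≡ 0ℚ
      vanish w = cong (λ b → if b then h (suc (suc (suc (suc w)))) else 0ℚ)
        (inR₁-far {x = suc zero} {suc (suc zero)} {suc (suc (suc (suc w)))}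
        (dist-≥ {i = 1} {4 ℕ.+ toℕ w} 2 (s≤s (s≤s z≤n)) (ℕP.+-monoʳ-≤ 5 (FinP.toℕ≤pred[n] w)))
        (dist-≥ {i = 2} {4 ℕ.+ toℕ w} 2 (s≤s (s≤s z≤n)) (ℕP.+-monoʳ-≤ 4 (ℕP.m≤n⇒m≤1+n (FinP.toℕ≤pred[n] w)))))

  distant-resolvers : ∀ w → let y = suc (suc (suc w)) in
                      All (λ z → inR₁ n zero y z ≡ true) (zero ∷ y ∷ suc zero ∷ suc (suc (inject₁ w)) ∷ [])
  distant-resolvers w = 0∈R ∷ y∈R ∷ 1∈R ∷ y⁻∈R ∷ []
    where
    y y⁻ : Fin n
    y  = suc (suc (suc w))
    y⁻ = suc (suc (inject₁ w))
    t : ℕ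
    t = toℕ w
    t≤1+j : t ≤ suc j
    t≤1+j = FinP.toℕ≤pred[n] w
    toℕ-y⁻ : toℕ y⁻ ≡ 2 ℕ.+ t
    toℕ-y⁻ = cong (2 ℕ.+_) (FinP.toℕ-inject₁ w)
    separated : ∀ z → d₁ n zero z ≢ d₁ n y z → inR₁ n zero y z ≡ true
    separated z = inR₁-separated {x = zero} {y} {z}
    1≤d[0,y] : 1 ≤ d₁ n zero y
    1≤d[0,y] = ℕP.⊓-glb (dist-≥ {i = 0} {3 ℕ.+ t} 1 (s≤s z≤n) (ℕP.+-monoʳ-≤ 4 t≤1+j)) (s≤s z≤n)
    d[y,1]≡2 : d₁ n y (suc zero) ≡ 2
    d[y,1]≡2 = ℕP.m≥n⇒m⊓n≡n (dist-≥ {i = 3 ℕ.+ t} {1} 2 (s≤s (s≤s z≤n)) (ℕP.+-monoʳ-≤ 4 t≤1+j))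
    d[0,y⁻]≡2 : d₁ n zero y⁻ ≡ 2
    d[0,y⁻]≡2 = ℕP.m≥n⇒m⊓n≡n (subst (2 ≤_) (sym (cycDist≡dist {x = zero} {y⁻} refl toℕ-y⁻))
                  (dist-≥ {i = 0} {2 ℕ.+ t} 2 (s≤s (s≤s z≤n)) (ℕP.+-monoʳ-≤ 4 t≤1+j)))
    d[y,y⁻]≡1 : d₁ n y y⁻ ≡ 1
    d[y,y⁻]≡1 = trans (cong (_⊓ 2) (cycDist≡dist {x = y} {y⁻} refl toℕ-y⁻))
                      (cong (λ d → (d ⊓ (n ∸ d)) ⊓ 2) (trans (ℕP.m≤n⇒∣n-m∣≡n∸m (ℕP.n≤1+n t)) (ℕP.m+n∸n≡m 1 t)))
    0∈R : inR₁ n zero y zero ≡ true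
    0∈R  = separated zero (ℕP.<⇒≢ 1≤d[0,y])
    y∈R : inR₁ n zero y y ≡ true
    y∈R  = separated y (λ d≡d → ℕP.<⇒≢ 1≤d[0,y] (sym (trans d≡d (cong (_⊓ 2) (dist-self n (3 ℕ.+ t))))))
    1∈R : inR₁ n zero y (suc zero) ≡ true
    1∈R  = separated (suc zero) (λ 1≡d → contradiction (trans 1≡d d[y,1]≡2) λ ())
    y⁻∈R : inR₁ n zero y y⁻ ≡ true
    y⁻∈R = separated y⁻ (λ d≡d → contradiction (trans (sym d[0,y⁻]≡2) (trans d≡d d[y,y⁻]≡1)) λ ())

  quarter-from-zero : ∀ y → y ≢ zero → 1ℚ ℚ.≤ weightR₁ n (const ¼) zero y
  quarter-from-zero zero y≢0 = contradiction refl y≢0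
  quarter-from-zero y@(suc zero) _ =
    four-resolvers-¼ {x = zero} {y} zero y (suc (suc zero)) (fromℕ (4 ℕ.+ j))
    (((λ ()) ∷ (λ ()) ∷ (λ ()) ∷ []) ∷ ((λ ()) ∷ (λ ()) ∷ []) ∷ ((λ ()) ∷ []) ∷ [] ∷ [])
    (refl ∷ refl ∷ refl ∷ inR₁-at-last {x = zero} {y} refl ∷ [])
  quarter-from-zero y@(suc (suc zero)) _ =
    four-resolvers-¼ {x = zero} {y} zero y (suc (suc (suc zero))) (fromℕ (4 ℕ.+ j))
    (((λ ()) ∷ (λ ()) ∷ (λ ()) ∷ []) ∷ ((λ ()) ∷ (λ ()) ∷ []) ∷ ((λ ()) ∷ []) ∷ [] ∷ [])
    (refl ∷ refl ∷ refl ∷ inR₁-at-last {x = zero} {y} refl ∷ [])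
  quarter-from-zero y@(suc (suc (suc w))) _ =
    four-resolvers-¼ {x = zero} {y} zero y (suc zero) (suc (suc (inject₁ w)))
    (((λ ()) ∷ (λ ()) ∷ (λ ()) ∷ []) ∷ ((λ ()) ∷ y≢y⁻ ∷ []) ∷ ((λ ()) ∷ []) ∷ [] ∷ [])
    (distant-resolvers w)
    where
    y≢y⁻ : y ≢ suc (suc (inject₁ w))
    y≢y⁻ y≡y⁻ = ℕP.1+n≢n (trans (cong toℕ y≡y⁻) (cong (2 ℕ.+_) (FinP.toℕ-inject₁ w)))

  dim-C₅₊ : Dim1f≡ n (+ n / 4)
  dim-C₅₊ = (const ¼ , ((λ _ → ¼-bounds) , resolving-from-zero ¼ quarter-from-zero) , ∑¼≡n/4)
          , λ h resolving → subst (ℚ._≤ sumV n h) (sum-const-1/ n 3)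
              (lower-bound-by-window (suc zero) (suc (suc zero)) (λ ()) (toℕ {4}) adjacent-pair-window
                (proj₁ ¼-bounds) refl h resolving)
    where
    ∑¼≡n/4 : sumV n (const ¼) ≡ + n / 4
    ∑¼≡n/4 = trans (sumV≡sum n (const ¼)) (sum-const-1/ n 3)

isTruncResolving? : ∀ n h → Dec (IsTruncResolving n h)
isTruncResolving? n h =
  FinP.all? (λ v → (0ℚ ℚP.≤? h v) ×-dec (h v ℚP.≤? 1ℚ)) ×-dec
  FinP.all? (λ x → FinP.all? (λ y → ¬? (x FinP.≟ y) →-dec (1ℚ ℚP.≤? weightR₁ n h x y)))

½ : ℚ
½ = + 1 / 2

½-nonNeg : 0ℚ ℚ.≤ ½
½-nonNeg = toWitness {a? = 0ℚ ℚP.≤? ½} _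

dim-C₃ : Dim1f≡ 3 (+ 3 / 2)
dim-C₃ = (const ½ , toWitness {a? = isTruncResolving? 3 (const ½)} _ , refl)
       , lower-bound-by-window zero (suc zero) (λ ()) (toℕ {2}) (λ h → ℚP.≤-refl) ½-nonNeg refl

dim-C₄ : Dim1f≡ 4 (+ 4 / 2)
dim-C₄ = (const ½ , toWitness {a? = isTruncResolving? 4 (const ½)} _ , refl)
       , lower-bound-by-window zero (suc (suc zero)) (λ ()) (λ i → 2 ℕ.* toℕ {2} i)
           (λ h → ℚP.≤-reflexive (cong (_+_ (h zero)) (ℚP.+-identityˡ _))) ½-nonNeg refl

corollary3p5 : (n : ℕ) → 3 ≤ n →
    ((n ≤ 4 → Dim1f≡ n ((+ n) / 2)) × (5 ≤ n → Dim1f≡ n ((+ n) / 4)))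
corollary3p5 0 ()
corollary3p5 1 (s≤s ())
corollary3p5 2 (s≤s (s≤s ()))
corollary3p5 3 _ = (λ _ → dim-C₃) , λ { (s≤s (s≤s (s≤s ()))) }
corollary3p5 4 _ = (λ _ → dim-C₄) , λ { (s≤s (s≤s (s≤s (s≤s ())))) }
corollary3p5 (suc (suc (suc (suc (suc j))))) _ = (λ { (s≤s (s≤s (s≤s (s≤s ())))) }) , λ _ → dim-C₅₊ j
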